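{- Let $(S,d_S)$ be a finite metric space and let $\lambda\ge 1$ be such that the linear program $\mathcal{L}$ has a feasible solution with this value of $\lambda$. Then $G(\lambda)$ contains no negative-weight cycle.
   Context: The linear program $\mathcal{L}$ has real variables $\lambda$ and $c_v$ ($v\in S$) and constraints $c_v\ge 0$ for all $v\in S$, and for all distinct $v,w\in S$: $c_v+c_w\ge d_S(v,w)$ and $c_v+c_w\le\lambda\cdot d_S(v,w)$. The directed graph $G(\lambda)$ has vertices $\overline{s},\underline{s}$ for each $s\in S$, an edge of weight $-d_S(s,t)$ from $\underline{s}$ to $\overline{t}$ for all $s,t\in S$ (including $s=t$, weight $0$), and an edge of weight $\lambda\cdot d_S(s,t)$ from $\overline{s}$ to $\underline{t}$ for all $s\neq t$. -}

module Defs where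

open import Level using (Level; _⊔_) renaming (suc to lsuc)
open import Algebra.Bundles using (CommutativeRing)
open import Relation.Binary.Core using (Rel)
open import Relation.Binary.Structures using (IsTotalOrder)
open import Relation.Binary.PropositionalEquality using (_≡_; _≢_)
open import Relation.Nullary using (¬_)
open import Data.Product using (_×_; ∃)
open import Data.Nat using (ℕ)
open import Data.Fin using (Fin)

-- An ordered field (ℝ is the intended instance; the statement is proved
-- for every ordered field, which includes ℝ).
record OrderedField (c ℓ : Level) : Set (lsuc (c ⊔ ℓ)) where
  field
    commutativeRing : CommutativeRing c ℓ
  open CommutativeRing commutativeRing public
  infix 4 _≤_ _<_
  field
    _≤_          : Rel Carrier ℓ
    isTotalOrder : IsTotalOrder _≈_ _≤_
    +-mono-≤     : ∀ {a b} z → a ≤ b → a + z ≤ b + z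
    *-nonneg     : ∀ {a b} → 0# ≤ a → 0# ≤ b → 0# ≤ a * b
    0≉1          : ¬ (0# ≈ 1#)
    inverse      : ∀ x → ¬ (x ≈ 0#) → ∃ λ y → x * y ≈ 1#

  _<_ : Rel Carrier ℓ
  a < b = a ≤ b × ¬ (a ≈ b)

module _ {c ℓ : Level} (F : OrderedField c ℓ) where
  open OrderedField F

  record FiniteMetric (n : ℕ) : Set (c ⊔ ℓ) where
    field
      d         : Fin n → Fin n → Carrier
      nonneg    : ∀ x y → 0# ≤ d x y
      zero→eq   : ∀ x y → d x y ≈ 0# → x ≡ y
      eq→zero   : ∀ x → d x x ≈ 0#
      symmetric : ∀ x y → d x y ≈ d y x
      triangle  : ∀ x y z → d x z ≤ d x y + d y z

  module _ {n : ℕ} (M : FiniteMetric n) where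
    open FiniteMetric M

    record LPFeasible (lam : Carrier) (cv : Fin n → Carrier) : Set (c ⊔ ℓ) where
      field
        c-nonneg : ∀ v → 0# ≤ cv v
        lower    : ∀ v w → v ≢ w → d v w ≤ cv v + cv w
        upper    : ∀ v w → v ≢ w → cv v + cv w ≤ lam * d v w

    -- Vertices of G(λ): over s  (\overline{s})  and  under s  (\underline{s}).
    data Vertex : Set where
      over  : Fin n → Vertex
      under : Fin n → Vertex

    data Edge : Vertex → Vertex → Set where
      down : (s t : Fin n) → Edge (under s) (over t)
      up   : (s t : Fin n) → s ≢ t → Edge (over s) (under t)

    weight : Carrier → ∀ {u v} → Edge u v → Carrier
    weight lam (down s t)   = - d s t
    weight lam (up s t _)   = lam * d s t

    data Walk : Vertex → Vertex → Set where
      []  : ∀ {v} → Walk v v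
      _∷_ : ∀ {u v w} → Edge u v → Walk v w → Walk u w

    walkWeight : Carrier → ∀ {u v} → Walk u v → Carrier
    walkWeight lam []       = 0#
    walkWeight lam (e ∷ p)  = weight lam e + walkWeight lam p

    record Cycle : Set where
      constructor cycle
      field
        {start} : Vertex
        {next}  : Vertex
        first   : Edge start next
        rest    : Walk next start
      walk : Walk start start
      walk = first ∷ rest

    cycleWeight : Carrier → Cycle → Carrier
    cycleWeight lam C = walkWeight lam (Cycle.walk C)

    HasNegativeCycle : Carrier → Set ℓ
    HasNegativeCycle lam = ∃ λ (C : Cycle) → cycleWeight lam C < 0#

module Submission where

-- The proof is the standard potential-function argument for shortest paths.
-- A potential for G(λ) is a function p on vertices with p(v) ≤ w(e) + p(u)
-- for every edge e : u → v.  Summing this along a walk gives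
-- p(v) ≤ w(walk) + p(u), so every closed walk, in particular every cycle, has
-- non-negative weight.  A feasible LP solution c yields the potential
--   p(s̄) = -c_s,   p(s̲) = c_s :
-- on an edge s̲ → t̄ the required inequality -c_t ≤ -d(s,t) + c_s is the lower
-- constraint d(s,t) ≤ c_s + c_t (for s = t it follows from c ≥ 0), and on an
-- edge s̄ → t̲ the inequality c_t ≤ λ·d(s,t) - c_s is the upper constraint.

open import Defs
open import Data.Nat using (ℕ)
open import Data.Fin using (Fin; _≟_)
open import Data.Product using (∃; _,_)
open import Relation.Nullary using (¬_; yes; no)
open import Relation.Binary.PropositionalEquality using (refl)
open import Relation.Binary.Structures using (IsTotalOrder)
open import Relation.Binary.Bundles using (Poset)
import Relation.Binary.Reasoning.PartialOrder as PosetReasoning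
import Algebra.Properties.Ring as RingProperties

module OrderedFieldFacts {c ℓ} (F : OrderedField c ℓ) where
  open OrderedField F
  open IsTotalOrder isTotalOrder public
    using (isPartialOrder; antisym) renaming (reflexive to ≤-reflexive)
  open RingProperties ring using (xyx⁻¹≈y)

  poset : Poset c ℓ ℓ
  poset = record { isPartialOrder = isPartialOrder }

  open PosetReasoning poset

  +-monoʳ-≤ : ∀ {a b} z → a ≤ b → z + a ≤ z + b
  +-monoʳ-≤ {a} {b} z a≤b = begin
    z + a  ≈⟨ +-comm z a ⟩
    a + z  ≤⟨ +-mono-≤ z a≤b ⟩
    b + z  ≈⟨ +-comm b z ⟩
    z + b  ∎

  +-cancelʳ-≤ : ∀ {a b} z → a + z ≤ b + z → a ≤ b
  +-cancelʳ-≤ {a} {b} z a+z≤b+z = begin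
    a            ≈⟨ sym (xyx⁻¹≈y z a) ⟩
    z + a + - z  ≈⟨ +-congʳ (+-comm z a) ⟩
    a + z + - z  ≤⟨ +-mono-≤ (- z) a+z≤b+z ⟩
    b + z + - z  ≈⟨ +-congʳ (+-comm b z) ⟩
    z + b + - z  ≈⟨ xyx⁻¹≈y z b ⟩
    b            ∎

  move-summand : ∀ {a b e} → a + b ≤ e → b ≤ e + - a
  move-summand {a} {b} {e} a+b≤e = +-cancelʳ-≤ a (begin
    b + a          ≈⟨ +-comm b a ⟩
    a + b          ≤⟨ a+b≤e ⟩
    e              ≈⟨ sym (+-identityʳ e) ⟩
    e + 0#         ≈⟨ +-congˡ (sym (-‿inverseˡ a)) ⟩
    e + (- a + a)  ≈⟨ sym (+-assoc e (- a) a) ⟩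
    e + - a + a    ∎)

  transpose : ∀ {x y z} → x ≤ y + z → - z ≤ - x + y
  transpose {x} {y} {z} x≤y+z = +-cancelʳ-≤ z (begin
    - z + z        ≈⟨ -‿inverseˡ z ⟩
    0#             ≈⟨ sym (-‿inverseˡ x) ⟩
    - x + x        ≤⟨ +-monoʳ-≤ (- x) x≤y+z ⟩
    - x + (y + z)  ≈⟨ sym (+-assoc (- x) y z) ⟩
    - x + y + z    ∎)

module Potentials {c ℓ} (F : OrderedField c ℓ) {n : ℕ} (M : FiniteMetric F n)
                  (lam : OrderedField.Carrier F) where
  open OrderedField F
  open OrderedFieldFacts F
  open PosetReasoning poset

  IsPotential : (Vertex F M → Carrier) → Set ℓ
  IsPotential p = ∀ {u v} (e : Edge F M u v) → p v ≤ weight F M lam e + p u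

  module _ {p : Vertex F M → Carrier} (potential : IsPotential p) where

    walk-bound : ∀ {u v} (w : Walk F M u v) → p v ≤ walkWeight F M lam w + p u
    walk-bound {u} []                     = ≤-reflexive (sym (+-identityˡ (p u)))
    walk-bound {u} {v} (_∷_ {v = m} e w) = begin
      p v                                              ≤⟨ walk-bound w ⟩
      walkWeight F M lam w + p m                       ≤⟨ +-monoʳ-≤ _ (potential e) ⟩
      walkWeight F M lam w + (weight F M lam e + p u)  ≈⟨ sym (+-assoc _ _ _) ⟩
      walkWeight F M lam w + weight F M lam e + p u    ≈⟨ +-congʳ (+-comm _ _) ⟩
      weight F M lam e + walkWeight F M lam w + p u    ∎

    closed-walk-nonneg : ∀ {u} (w : Walk F M u u) → 0# ≤ walkWeight F M lam w
    closed-walk-nonneg {u} w = +-cancelʳ-≤ (p u) (begin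
      0# + p u                   ≈⟨ +-identityˡ (p u) ⟩
      p u                        ≤⟨ walk-bound w ⟩
      walkWeight F M lam w + p u ∎)

    no-negative-cycle : ¬ HasNegativeCycle F M lam
    no-negative-cycle (C , (W≤0 , W≉0)) =
      W≉0 (antisym W≤0 (closed-walk-nonneg (Cycle.walk C)))

module LPPotential {c ℓ} (F : OrderedField c ℓ) {n : ℕ} (M : FiniteMetric F n)
                   {lam : OrderedField.Carrier F} {cv : Fin n → OrderedField.Carrier F}
                   (feasible : LPFeasible F M lam cv) where
  open OrderedField F
  open OrderedFieldFacts F
  open PosetReasoning poset
  open FiniteMetric M
  open LPFeasible feasible
  open Potentials F M lam using (IsPotential)

  lower-all : ∀ s t → d s t ≤ cv s + cv t
  lower-all s t with s ≟ t
  ... | no s≢t = lower s t s≢t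
  ... | yes refl = begin
    d s s          ≈⟨ eq→zero s ⟩
    0#             ≈⟨ sym (+-identityʳ 0#) ⟩
    0# + 0#        ≤⟨ +-mono-≤ 0# (c-nonneg s) ⟩
    cv s + 0#      ≤⟨ +-monoʳ-≤ (cv s) (c-nonneg s) ⟩
    cv s + cv s    ∎

  lpPotential : Vertex F M → Carrier
  lpPotential (over t)  = - cv t
  lpPotential (under s) = cv s

  lpPotential-isPotential : IsPotential lpPotential
  lpPotential-isPotential (down s t)   = transpose (lower-all s t)
  lpPotential-isPotential (up s t s≢t) = move-summand (upper s t s≢t)

lemma3 : ∀ {c ℓ} (F : OrderedField c ℓ) (n : ℕ) (M : FiniteMetric F n)
    (lam : OrderedField.Carrier F) →
    OrderedField._≤_ F (OrderedField.1# F) lam →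
    ∃ (LPFeasible F M lam) →
    ¬ HasNegativeCycle F M lam
lemma3 F n M lam _ (cv , feasible) =
  Potentials.no-negative-cycle F M lam (LPPotential.lpPotential-isPotential F M feasible)
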